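{- Let $n\ge1$. (i) For the star $S_n$ on $n+1$ vertices, $\pi_{fl}(S_n)=2$. (ii) For every subdivision $S$ of a star $S_n$, $\pi_{fl}(S)\le5$. (iii) For the wheel $W_n$ on $n+1$ vertices ($n\ge3$), with its standard plane embedding, $\pi_{fl}(W_n)\le 6$.
   Context: The star $S_n$ is obtained by joining one central vertex to the $n$ vertices of an independent set; the wheel $W_n$ is obtained by joining a central vertex to all $n$ vertices of a cycle. A sequence $r_1\dots r_{2n}$ is a repetition if $r_i=r_{n+i}$ for all $i\le n$. In a plane graph $G$, a facial path is a path whose vertices and edges are consecutive on the boundary walk of some face of $G$. A vertex colouring is facial non-repetitive if no facial path on vertices $v_1,\dots,v_{2n}$ ($n\ge1$) has colour sequence that is a repetition. $\pi_{fl}(G)$ is the minimum $l$ such that for every assignment of lists $L(v)\subseteq\mathbb{Z}_+$ with $|L(v)|\ge l$ there is a facial non-repetitive colouring $\varphi$ with $\varphi(v)\in L(v)$ for every vertex $v$. -}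

module Defs where

open import Data.Nat using (ℕ; zero; suc; _≤_; _<_)
open import Data.Fin using (Fin; inject₁)
open import Data.List using (List; []; _∷_; _++_; map; concat; length; drop; take; reverse; zip; allFin)
open import Data.List.Membership.Propositional using (_∈_)
open import Data.List.Relation.Unary.All using (All)
open import Data.List.Relation.Unary.Unique.Propositional using (Unique)
open import Data.Maybe using (Maybe; just; nothing)
open import Data.Product using (Σ; _×_; _,_; ∃; ∃-syntax)
open import Data.Sum using (_⊎_)
open import Relation.Binary.PropositionalEquality using (_≡_; _≢_)
open import Relation.Nullary using (¬_)

-- Plane graphs, represented by their vertex type and the list of the
-- (closed, cyclic) boundary walks of their faces.  Consecutive vertices
-- of a walk (including last -> first) are joined by a boundary edge.

record PlaneGraph : Set₁ where
  field
    V     : Set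
    faces : List (List V)
open PlaneGraph public

rotate : {A : Set} → ℕ → List A → List A
rotate k w = drop k w ++ take k w

Segment : {A : Set} → List A → List A → Set
Segment p w = Σ ℕ λ k → k < length w × Σ _ λ rest → p ++ rest ≡ rotate k w

FacialPath : (G : PlaneGraph) → List (V G) → Set
FacialPath G p = Σ (List (V G)) λ w → w ∈ faces G × p ≢ [] × Unique p
                   × (Segment p w ⊎ Segment (reverse p) w)

IsRepetition : List ℕ → Set
IsRepetition xs = Σ (List ℕ) λ ys → ys ≢ [] × xs ≡ ys ++ ys

FacialNonRepetitive : (G : PlaneGraph) → (V G → ℕ) → Set
FacialNonRepetitive G φ = (p : List (V G)) → FacialPath G p → ¬ IsRepetition (map φ p)

ListAssignment : (G : PlaneGraph) → ℕ → (V G → List ℕ) → Set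
ListAssignment G l L = (v : V G) → Unique (L v) × All (λ c → 1 ≤ c) (L v) × l ≤ length (L v)

FNRChoosable : PlaneGraph → ℕ → Set
FNRChoosable G l = (L : V G → List ℕ) → ListAssignment G l L →
  Σ (V G → ℕ) λ φ → ((v : V G) → φ v ∈ L v) × FacialNonRepetitive G φ

PiFL≡ : PlaneGraph → ℕ → Set
PiFL≡ G k = FNRChoosable G k × ((l : ℕ) → FNRChoosable G l → k ≤ l)

-- π_fl(G) ≤ k  (i.e. the minimum exists and is ≤ k; equivalently,
-- by monotonicity, G is FNR k-choosable)
PiFL≤ : PlaneGraph → ℕ → Set
PiFL≤ G k = FNRChoosable G k

-- Star S_n: centre `nothing`, leaves `just i`.  Single face, boundary walk
-- c v₁ c v₂ … c vₙ (closing back to c).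

star : ℕ → PlaneGraph
star n = record
  { V = Maybe (Fin n)
  ; faces = concat (map (λ i → nothing ∷ just i ∷ []) (allFin n)) ∷ [] }

-- Subdivision of S_n: edge c–vᵢ is replaced by a path with ks i internal
-- vertices.  Vertex `just (i , j)` is the vertex on branch i at distance
-- j+1 from the centre (j = ks i is the leaf).  Single face, boundary walk
-- going out and back along each branch in turn.

SubStarV : (n : ℕ) → (Fin n → ℕ) → Set
SubStarV n ks = Maybe (Σ (Fin n) λ i → Fin (suc (ks i)))

subStarBranch : (n : ℕ) (ks : Fin n → ℕ) → Fin n → List (SubStarV n ks)
subStarBranch n ks i =
  nothing ∷ (map (λ j → just (i , j)) (allFin (suc (ks i)))
             ++ reverse (map (λ j → just (i , inject₁ j)) (allFin (ks i))))

subdividedStar : (n : ℕ) → (Fin n → ℕ) → PlaneGraph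
subdividedStar n ks = record
  { V = SubStarV n ks
  ; faces = concat (map (subStarBranch n ks) (allFin n)) ∷ [] }

-- Wheel W_n, standard embedding: hub `nothing`, rim `just 0 … just (n-1)`
-- in cyclic order.  Faces: the triangles hub, rᵢ, rᵢ₊₁ and the outer face
-- bounded by the rim cycle.

wheel : ℕ → PlaneGraph
wheel n = record
  { V = Maybe (Fin n)
  ; faces = rim ∷ map (λ e → nothing ∷ Data.Product.proj₁ e ∷ Data.Product.proj₂ e ∷ [])
                      (zip rim (rotate 1 rim)) }
  where
  rim : List (Maybe (Fin n))
  rim = map just (allFin n)

-- Give the centre (the hub) a colour that is then deleted from every other list.  A vertex
-- whose colour occurs nowhere else lies on no repetitive path, as its colour would appear in
-- both halves; so a repetitive facial path avoids the centre and runs inside a single leaf of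
-- the star, inside one branch of a subdivided star (out towards the leaf and possibly back),
-- or along the rim of the wheel.  The branches, and the rim minus one more reserved vertex,
-- are paths whose lists keep at least 4 colours, and they are coloured square-free by
-- Rosenfeld's counting argument: let Cₖ count the square-free choices from the last k lists
-- and Dₖ be the sum of the Cᵢ with i < k.  A choice x w with w square-free is square-free or
-- begins with a square uu, and is then determined by its suffix after the first u; hence
-- 4Cₖ ≤ Cₖ₊₁ + Cₖ + Dₖ, and by induction Dₖ ≤ Cₖ, so Cₖ₊₁ ≥ 2Cₖ ≥ 1.  For the lower bound on
-- the star, constant lists {1} make an edge from the centre to a leaf a repetition.

module Submission where

open import Defs
open import Data.Empty using (⊥-elim)
open import Data.Fin using (Fin; zero; suc; inject₁; fromℕ)
open import Data.List
  using (List; []; _∷_; _++_; [_]; map; concat; length; take; drop; reverse; tabulate; allFin;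
         zip; filter)
open import Data.List.Properties
  using (∷-injectiveˡ; ∷-injectiveʳ; ++-assoc; ++-identityʳ; ++-conicalˡ; ++-conicalʳ; ≡-dec;
         length-++-≤ˡ; length-++-≤ʳ; length-map; length-take; map-++; map-∘; map-tabulate;
         take++drop≡id; reverse-++; reverse-involutive; reverse-injective; unfold-reverse;
         reverse-map; filter-all; filter-reject; filter-accept)
open import Data.List.Membership.Propositional using (_∈_; _∉_)
open import Data.List.Membership.Propositional.Properties
  using (∈-map⁺; ∈-map⁻; ∈-++⁺ʳ; ∈-++⁻; ∈-filter⁻)
open import Data.List.Relation.Binary.Permutation.Propositional using (↭-sym; ↭⇒↭ₛ)
open import Data.List.Relation.Binary.Permutation.Propositional.Properties using (↭-reverse)
import Data.List.Relation.Binary.Permutation.Setoid.Properties as Permutationₛ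
open import Data.List.Relation.Binary.Pointwise using (Pointwise; []; _∷_)
open import Data.List.Relation.Unary.All as All using (All; []; _∷_)
open import Data.List.Relation.Unary.All.Properties using (take⁺; tabulate⁺)
open import Data.List.Relation.Unary.Any using (here; there)
open import Data.List.Relation.Unary.Any.Properties using (reverse⁻)
open import Data.List.Relation.Unary.AllPairs using ([]; _∷_)
open import Data.List.Relation.Unary.Unique.Propositional using (Unique)
open import Data.List.Relation.Unary.Unique.Propositional.Properties using (filter⁺)
open import Data.Maybe using (Maybe; just; nothing)
open import Data.Nat using (ℕ; zero; suc; _+_; _*_; _≤_; z≤n; s≤s; _≤?_)
import Data.Nat as ℕ
open import Data.Nat.Properties
open import Algebra.Properties.CommutativeSemigroup +-commutativeSemigroup
  using (interchange; x∙yz≈y∙xz)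
open import Data.Product using (∃; ∃₂; _×_; _,_; proj₁; proj₂; map₂; uncurry)
open import Data.Sum using (_⊎_; inj₁; inj₂)
open import Function using (_∘_; id)
open import Relation.Binary.Definitions using (DecidableEquality)
open import Relation.Binary.PropositionalEquality hiding ([_])
open import Relation.Nullary using (¬_; Dec; yes; no; ¬?)

-- Infixes of words

module _ {A : Set} where

  Infix : List A → List A → Set
  Infix q w = ∃₂ λ as bs → as ++ q ++ bs ≡ w

  SquareFree : List A → Set
  SquareFree w = ∀ ys → ys ≢ [] → ¬ Infix (ys ++ ys) w

  infix-∷ : ∀ {q w} x → Infix q w → Infix q (x ∷ w)
  infix-∷ x (as , bs , e) = x ∷ as , bs , cong (x ∷_) e

  infix-++ˡ : ∀ {q Z} X → Infix q Z → Infix q (X ++ Z)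
  infix-++ˡ []      i = i
  infix-++ˡ (x ∷ X) i = infix-∷ x (infix-++ˡ X i)

  infix-++ʳ : ∀ {q X} Z → Infix q X → Infix q (X ++ Z)
  infix-++ʳ {q} Z (as , bs , refl) =
    as , bs ++ Z , sym (trans (++-assoc as (q ++ bs) Z) (cong (as ++_) (++-assoc q bs Z)))

  infix-trans : ∀ {p q w} → Infix p q → Infix q w → Infix p w
  infix-trans i (cs , ds , refl) = infix-++ˡ cs (infix-++ʳ ds i)

  infix-reverse : ∀ {q w} → Infix q w → Infix (reverse q) (reverse w)
  infix-reverse {q} (as , bs , refl) = reverse bs , reverse as , (begin
    reverse bs ++ reverse q ++ reverse as   ≡⟨ ++-assoc (reverse bs) (reverse q) (reverse as) ⟨
    (reverse bs ++ reverse q) ++ reverse as ≡⟨ cong (_++ reverse as) (reverse-++ q bs) ⟨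
    reverse (q ++ bs) ++ reverse as         ≡⟨ reverse-++ as (q ++ bs) ⟨
    reverse (as ++ q ++ bs)                 ∎)
    where open ≡-Reasoning

  infix-length : ∀ {q w} → Infix q w → length q ≤ length w
  infix-length {q} (as , bs , refl) = ≤-trans (length-++-≤ˡ q) (length-++-≤ʳ (q ++ bs) {as})

  infix-∷⁻ : ∀ {c q Z} → c ∉ q → Infix q (c ∷ Z) → Infix q Z
  infix-∷⁻ {q = []}    _   _                 = [] , _ , refl
  infix-∷⁻ {q = _ ∷ _} c∉q ([] , _ , e)      = ⊥-elim (c∉q (here (sym (∷-injectiveˡ e))))
  infix-∷⁻             _   (_ ∷ as , bs , e) = as , bs , ∷-injectiveʳ e

  Straddles : List A → List A → List A → Set
  Straddles q X Z = ∃₂ λ q₁ q₂ → q ≡ q₁ ++ q₂ × q₁ ≢ [] × q₂ ≢ []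
                      × (∃ λ t → t ++ q₁ ≡ X) × (∃ λ r → q₂ ++ r ≡ Z)

  prefix-++⁻ : ∀ {q bs : List A} X {Z} → q ++ bs ≡ X ++ Z →
    (∃ λ cs → q ++ cs ≡ X) ⊎ (∃ λ q₂ → q ≡ X ++ q₂ × q₂ ≢ [] × q₂ ++ bs ≡ Z)
  prefix-++⁻ {[]}    X       e = inj₁ (X , refl)
  prefix-++⁻ {y ∷ q} []      e = inj₂ (y ∷ q , refl , (λ ()) , e)
  prefix-++⁻ {y ∷ q} (x ∷ X) e with ∷-injectiveˡ e | prefix-++⁻ {q} X (∷-injectiveʳ e)
  ... | refl | inj₁ (cs , e′)            = inj₁ (cs , cong (y ∷_) e′)
  ... | refl | inj₂ (q₂ , refl , n , e′) = inj₂ (q₂ , refl , n , e′)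

  infix-++⁻ : ∀ {q} X {Z} → Infix q (X ++ Z) → Infix q X ⊎ Infix q Z ⊎ Straddles q X Z
  infix-++⁻ []      i = inj₂ (inj₁ i)
  infix-++⁻ {q} (x ∷ X) ([] , bs , e) with prefix-++⁻ {q} (x ∷ X) e
  ... | inj₁ (cs , e′)            = inj₁ ([] , cs , e′)
  ... | inj₂ (q₂ , refl , n , e′) =
    inj₂ (inj₂ (x ∷ X , q₂ , refl , (λ ()) , n , ([] , refl) , bs , e′))
  infix-++⁻ (x ∷ X) (_ ∷ as , bs , e) with infix-++⁻ X (as , bs , ∷-injectiveʳ e)
  ... | inj₁ i        = inj₁ (infix-∷ x i)
  ... | inj₂ (inj₁ i) = inj₂ (inj₁ i)
  ... | inj₂ (inj₂ (q₁ , q₂ , eq , n₁ , n₂ , (t , et) , suffix)) =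
    inj₂ (inj₂ (q₁ , q₂ , eq , n₁ , n₂ , (x ∷ t , cong (x ∷_) et) , suffix))

  infix-++-∷⁻ : ∀ {c q} X {Z} → c ∉ q → Infix q (X ++ c ∷ Z) → Infix q X ⊎ Infix q Z
  infix-++-∷⁻ X c∉q i with infix-++⁻ X i
  ... | inj₁ i′        = inj₁ i′
  ... | inj₂ (inj₁ i′) = inj₂ (infix-∷⁻ c∉q i′)
  ... | inj₂ (inj₂ (q₁ , [] , _ , _ , q₂≢[] , _)) = ⊥-elim (q₂≢[] refl)
  ... | inj₂ (inj₂ (q₁ , _ ∷ _ , refl , _ , _ , _ , _ , e)) =
    ⊥-elim (c∉q (∈-++⁺ʳ q₁ (here (sym (∷-injectiveˡ e)))))

  rotation-avoiding : ∀ {c q} k R → c ∉ q → Infix q (rotate k (c ∷ R)) → Infix q R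
  rotation-avoiding zero    R c∉q i = subst (Infix _) (++-identityʳ R) (infix-∷⁻ c∉q i)
  rotation-avoiding (suc k) R c∉q i with infix-++-∷⁻ (drop k R) c∉q i
  ... | inj₁ i′ = subst (Infix _) (take++drop≡id k R) (infix-++ˡ (take k R) i′)
  ... | inj₂ i′ = subst (Infix _) (take++drop≡id k R) (infix-++ʳ (drop k R) i′)

  segment-avoiding : ∀ {c q R} → Segment q (c ∷ R) → c ∉ q → Infix q R
  segment-avoiding {R = R} (k , _ , rest , e) c∉q = rotation-avoiding k R c∉q ([] , rest , e)

  segment-blocks : ∀ {I : Set} {c q} (B : I → List A) is →
    Segment q (concat (map (λ i → c ∷ B i) is)) → c ∉ q → ∃ λ i → Infix q (B i)
  segment-blocks B []       (_ , () , _)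
  segment-blocks B (i ∷ is) seg c∉q = blocks i is (segment-avoiding seg c∉q)
    where
    blocks : ∀ i is → Infix _ (B i ++ concat (map (λ j → _ ∷ B j) is)) → ∃ λ j → Infix _ (B j)
    blocks i []       inf = i , subst (Infix _) (++-identityʳ (B i)) inf
    blocks i (j ∷ is) inf with infix-++-∷⁻ (B i) c∉q inf
    ... | inj₁ inf′ = i , inf′
    ... | inj₂ inf′ = blocks j is inf′

  ∈-head : ∀ {xs ys : List A} {y zs} → xs ≢ [] → xs ++ ys ≡ y ∷ zs → y ∈ xs
  ∈-head {[]}    xs≢[] _ = ⊥-elim (xs≢[] refl)
  ∈-head {_ ∷ _} _     e = here (sym (∷-injectiveˡ e))

  unique-++-disjoint : ∀ {xs ys : List A} {y} → Unique (xs ++ ys) → y ∈ xs → y ∉ ys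
  unique-++-disjoint {_ ∷ xs} (x∉xs ∷ _) (here refl) y∈ys =
    All.lookup x∉xs (∈-++⁺ʳ xs y∈ys) refl
  unique-++-disjoint (_ ∷ u) (there y∈xs) = unique-++-disjoint u y∈xs

  unique-reverse : ∀ {q : List A} → Unique q → Unique (reverse q)
  unique-reverse {q} = Permutationₛ.Unique-resp-↭ (setoid A) (↭⇒↭ₛ (↭-sym (↭-reverse q)))

  -- On the walk T x Tᴿ out to a leaf x and back, a path meeting both copies of T
  -- would contain the vertex next to x twice.
  out-and-back : ∀ {q S} T x → S ≡ T ++ [ x ] → Unique q →
    Infix q (S ++ reverse T) → Infix q S ⊎ Infix (reverse q) S
  out-and-back T x refl u i with infix-++⁻ T (subst (Infix _) (++-assoc T [ x ] (reverse T)) i)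
  ... | inj₁ i′        = inj₁ (infix-++ʳ [ x ] i′)
  ... | inj₂ (inj₁ i′) = inj₂ (subst (Infix _) Tx≡ (infix-reverse i′))
    where
    Tx≡ : reverse (x ∷ reverse T) ≡ T ++ [ x ]
    Tx≡ = trans (unfold-reverse x (reverse T)) (cong (_++ [ x ]) (reverse-involutive T))
  ... | inj₂ (inj₂ (_ , [] , _ , _ , q₂≢[] , _)) = ⊥-elim (q₂≢[] refl)
  ... | inj₂ (inj₂ (q₁ , _ ∷ [] , refl , _ , _ , (t , refl) , _ , e)) rewrite ∷-injectiveˡ e =
    inj₁ (t , [] , trans (cong (t ++_) (++-identityʳ _)) (sym (++-assoc t q₁ [ x ])))
  ... | inj₂ (inj₂ (q₁ , _ ∷ y ∷ _ , refl , q₁≢[] , _ , (t , refl) , _ , e)) =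
    ⊥-elim (unique-++-disjoint u y∈q₁ (there (here refl)))
    where
    y∈q₁ : y ∈ q₁
    y∈q₁ = reverse⁻ (∈-head (q₁≢[] ∘ reverse-injective {x = q₁} {y = []})
                            (trans (sym (reverse-++ t q₁)) (sym (∷-injectiveʳ e))))

  take-length-++ : ∀ (a b : List A) → take (length a) (a ++ b) ≡ a
  take-length-++ []      b = refl
  take-length-++ (x ∷ a) b = cong (x ∷_) (take-length-++ a b)

  drop-length-++ : ∀ (a b : List A) → drop (length a) (a ++ b) ≡ b
  drop-length-++ []      b = refl
  drop-length-++ (x ∷ a) b = drop-length-++ a b

  length-positive : ∀ {xs : List A} → xs ≢ [] → 1 ≤ length xs
  length-positive {[]}    xs≢[] = ⊥-elim (xs≢[] refl)
  length-positive {_ ∷ _} _     = s≤s z≤n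

-- Counting square-free choices

𝟙 : ∀ {P : Set} → Dec P → ℕ
𝟙 (yes _) = 1
𝟙 (no _)  = 0

𝟙≤1 : ∀ {P : Set} (d : Dec P) → 𝟙 d ≤ 1
𝟙≤1 (yes _) = ≤-refl
𝟙≤1 (no _)  = z≤n

𝟙-yes : ∀ {P : Set} (d : Dec P) → P → 𝟙 d ≡ 1
𝟙-yes (yes _) _ = refl
𝟙-yes (no ¬p) p = ⊥-elim (¬p p)

𝟙-no : ∀ {P : Set} (d : Dec P) → ¬ P → 𝟙 d ≡ 0
𝟙-no (yes p) ¬p = ⊥-elim (¬p p)
𝟙-no (no _)  _  = refl

𝟙-cong : ∀ {P Q : Set} (d : Dec P) (e : Dec Q) → (P → Q) → (Q → P) → 𝟙 d ≡ 𝟙 e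
𝟙-cong (yes _) (yes _) _ _ = refl
𝟙-cong (no _)  (no _)  _ _ = refl
𝟙-cong (yes p) (no ¬q) f _ = ⊥-elim (¬q (f p))
𝟙-cong (no ¬p) (yes q) _ g = ⊥-elim (¬p (g q))

*𝟙≤ : ∀ m {P : Set} (d : Dec P) → m * 𝟙 d ≤ m
*𝟙≤ m d = ≤-trans (*-monoʳ-≤ m (𝟙≤1 d)) (≤-reflexive (*-identityʳ m))

*𝟙-positive : ∀ m {P : Set} (d : Dec P) → 1 ≤ m * 𝟙 d → 1 ≤ m × P
*𝟙-positive m (yes p) pos = subst (1 ≤_) (*-identityʳ m) pos , p
*𝟙-positive m (no _)  pos with () ← subst (1 ≤_) (*-zeroʳ m) pos

module _ {B : Set} where

  ∑ : List B → (B → ℕ) → ℕ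
  ∑ []       g = 0
  ∑ (x ∷ xs) g = g x + ∑ xs g

  ∑-cong : ∀ xs {g h : B → ℕ} → (∀ x → g x ≡ h x) → ∑ xs g ≡ ∑ xs h
  ∑-cong []       _ = refl
  ∑-cong (x ∷ xs) e = cong₂ _+_ (e x) (∑-cong xs e)

  ∑-mono : ∀ xs {g h : B → ℕ} → (∀ x → g x ≤ h x) → ∑ xs g ≤ ∑ xs h
  ∑-mono []       _  = z≤n
  ∑-mono (x ∷ xs) le = +-mono-≤ (le x) (∑-mono xs le)

  ∑-+ : ∀ xs (g h : B → ℕ) → ∑ xs (λ x → g x + h x) ≡ ∑ xs g + ∑ xs h
  ∑-+ []       g h = refl
  ∑-+ (x ∷ xs) g h =
    trans (cong (g x + h x +_) (∑-+ xs g h)) (interchange (g x) (h x) (∑ xs g) (∑ xs h))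

  ∑-const : ∀ xs c → ∑ xs (λ _ → c) ≡ length xs * c
  ∑-const []       c = refl
  ∑-const (x ∷ xs) c = cong (c +_) (∑-const xs c)

  ∑-zero : ∀ {xs} {g : B → ℕ} → All (λ x → g x ≡ 0) xs → ∑ xs g ≡ 0
  ∑-zero []       = refl
  ∑-zero (z ∷ zs) = cong₂ _+_ z (∑-zero zs)

  ∑-positive : ∀ xs (g : B → ℕ) → 1 ≤ ∑ xs g → ∃ λ x → x ∈ xs × 1 ≤ g x
  ∑-positive (x ∷ xs) g pos with g x in eq
  ... | suc _ = x , here refl , subst (1 ≤_) (sym eq) (s≤s z≤n)
  ... | zero with ∑-positive xs g pos
  ...   | y , y∈xs , pos′ = y , there y∈xs , pos′

  ∑words : List (List B) → (List B → ℕ) → ℕ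
  ∑words []       f = f []
  ∑words (L ∷ Ls) f = ∑ L λ x → ∑words Ls (f ∘ (x ∷_))

  ∑words-cong : ∀ Ls {f g : List B → ℕ} → (∀ w → f w ≡ g w) →
    ∑words Ls f ≡ ∑words Ls g
  ∑words-cong []       e = e []
  ∑words-cong (L ∷ Ls) e = ∑-cong L (λ x → ∑words-cong Ls (e ∘ (x ∷_)))

  ∑words-mono : ∀ Ls {f g : List B → ℕ} → (∀ w → length w ≡ length Ls → f w ≤ g w) →
    ∑words Ls f ≤ ∑words Ls g
  ∑words-mono []       le = le [] refl
  ∑words-mono (L ∷ Ls) le =
    ∑-mono L (λ x → ∑words-mono Ls (λ w e → le (x ∷ w) (cong suc e)))

  ∑words-+ : ∀ Ls (f g : List B → ℕ) →
    ∑words Ls (λ w → f w + g w) ≡ ∑words Ls f + ∑words Ls g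
  ∑words-+ []       f g = refl
  ∑words-+ (L ∷ Ls) f g =
    trans (∑-cong L (λ x → ∑words-+ Ls (f ∘ (x ∷_)) (g ∘ (x ∷_)))) (∑-+ L _ _)

  ∑words-zero : ∀ Ls {f : List B → ℕ} → (∀ w → f w ≡ 0) → ∑words Ls f ≡ 0
  ∑words-zero []       z = z []
  ∑words-zero (L ∷ Ls) z = ∑-zero (All.universal (λ x → ∑words-zero Ls (z ∘ (x ∷_))) L)

  ∑words-++ : ∀ Ls Ms (f : List B → ℕ) →
    ∑words (Ls ++ Ms) f ≡ ∑words Ls (λ u → ∑words Ms (f ∘ (u ++_)))
  ∑words-++ []       Ms f = refl
  ∑words-++ (L ∷ Ls) Ms f = ∑-cong L (λ x → ∑words-++ Ls Ms (f ∘ (x ∷_)))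

  ∑-∑words : ∀ xs Ms (k : B → List B → ℕ) →
    ∑ xs (λ x → ∑words Ms (k x)) ≡ ∑words Ms (λ v → ∑ xs (λ x → k x v))
  ∑-∑words []       Ms k = sym (∑words-zero Ms (λ _ → refl))
  ∑-∑words (x ∷ xs) Ms k =
    trans (cong (∑words Ms (k x) +_) (∑-∑words xs Ms k)) (sym (∑words-+ Ms (k x) _))

  ∑words-comm : ∀ Ls Ms (h : List B → List B → ℕ) →
    ∑words Ls (λ u → ∑words Ms (h u)) ≡ ∑words Ms (λ v → ∑words Ls (λ u → h u v))
  ∑words-comm []       Ms h = refl
  ∑words-comm (L ∷ Ls) Ms h =
    trans (∑-cong L (λ x → ∑words-comm Ls Ms (h ∘ (x ∷_)))) (∑-∑words L Ms _)

  ∑words-positive : ∀ Ls (f : List B → ℕ) → 1 ≤ ∑words Ls f →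
    ∃ λ w → Pointwise _∈_ w Ls × 1 ≤ f w
  ∑words-positive []       f pos = [] , [] , pos
  ∑words-positive (L ∷ Ls) f pos with ∑-positive L _ pos
  ... | x , x∈L , pos′ with ∑words-positive Ls (f ∘ (x ∷_)) pos′
  ...   | w , w∈Ls , pos″ = x ∷ w , x∈L ∷ w∈Ls , pos″

  pointwise-tabulate⁻ : ∀ {m} {L : Fin m → List B} {w} → Pointwise _∈_ w (tabulate L) →
    ∃ λ c → (∀ t → c t ∈ L t) × tabulate c ≡ w
  pointwise-tabulate⁻ {zero}  []            = (λ ()) , (λ ()) , refl
  pointwise-tabulate⁻ {suc m} (x∈L₀ ∷ w∈Ls) with pointwise-tabulate⁻ w∈Ls
  ... | c , c∈L , refl =
    (λ { zero → _ ; (suc t) → c t }) , (λ { zero → x∈L₀ ; (suc t) → c∈L t }) , refl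

module _ {A : Set} (_≟_ : DecidableEquality A) where

  ∑-≤-support : ∀ xs {y} {g : A → ℕ} → Unique xs → (∀ x → x ≢ y → g x ≡ 0) →
    ∑ xs g ≤ g y
  ∑-≤-support []       _ _ = z≤n
  ∑-≤-support (x ∷ xs) {y} {g} (x∉xs ∷ u) z with x ≟ y
  ... | yes refl =
    ≤-reflexive (trans (cong (g x +_) (∑-zero (All.map (λ x≢x′ → z _ (x≢x′ ∘ sym)) x∉xs)))
                       (+-identityʳ (g x)))
  ... | no x≢y = ≤-trans (≤-reflexive (cong (_+ ∑ xs g) (z x x≢y))) (∑-≤-support xs u z)

  δ : List A → List A → ℕ
  δ u v = 𝟙 (≡-dec _≟_ u v)

  δ-∷ : ∀ x u v → δ (x ∷ u) (x ∷ v) ≡ δ u v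
  δ-∷ x u v = 𝟙-cong (≡-dec _≟_ (x ∷ u) (x ∷ v)) (≡-dec _≟_ u v) ∷-injectiveʳ (cong (x ∷_))

  δ-∷-≢ : ∀ {x y} u v → x ≢ y → δ (x ∷ u) (y ∷ v) ≡ 0
  δ-∷-≢ {x} {y} u v x≢y = 𝟙-no (≡-dec _≟_ (x ∷ u) (y ∷ v)) (x≢y ∘ ∷-injectiveˡ)

  -- all lists being duplicate-free, at most one word equals t
  ∑words-δ : ∀ Ls → All Unique Ls → ∀ t c → ∑words Ls (λ u → δ u t * c) ≤ c
  ∑words-δ []       []         t       c =
    ≤-trans (*-monoˡ-≤ c (𝟙≤1 (≡-dec _≟_ [] t))) (≤-reflexive (*-identityˡ c))
  ∑words-δ (L ∷ Ls) (_ ∷ _)    []      c =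
    ≤-trans (≤-reflexive (∑-zero (All.universal (λ _ → ∑words-zero Ls (λ _ → refl)) L))) z≤n
  ∑words-δ (L ∷ Ls) (uL ∷ uLs) (y ∷ t) c = begin
    ∑ L (λ x → ∑words Ls (λ w → δ (x ∷ w) (y ∷ t) * c))
      ≤⟨ ∑-≤-support L uL (λ x x≢y → ∑words-zero Ls (λ w → cong (_* c) (δ-∷-≢ w t x≢y))) ⟩
    ∑words Ls (λ w → δ (y ∷ w) (y ∷ t) * c)
      ≡⟨ ∑words-cong Ls (λ w → cong (_* c) (δ-∷ y w t)) ⟩
    ∑words Ls (λ w → δ w t * c)
      ≤⟨ ∑words-δ Ls uLs t c ⟩
    c ∎
    where open ≤-Reasoning

  squarePrefix : ℕ → List A → ℕ
  squarePrefix j u = δ (take j u) (take j (drop j u))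

  squarePrefix-++ : ∀ a b → squarePrefix (length a) (a ++ b) ≡ δ a (take (length a) b)
  squarePrefix-++ a b rewrite take-length-++ a b | drop-length-++ a b = refl

  squarePrefixes : ℕ → List A → ℕ
  squarePrefixes zero    u = 0
  squarePrefixes (suc j) u = squarePrefix (suc j) u + squarePrefixes j u

  squarePrefix≤squarePrefixes : ∀ {j} m u → 1 ≤ j → j ≤ m →
    squarePrefix j u ≤ squarePrefixes m u
  squarePrefix≤squarePrefixes zero    u (s≤s _) ()
  squarePrefix≤squarePrefixes (suc m) u 1≤j j≤1+m with m≤n⇒m<n∨m≡n j≤1+m
  ... | inj₂ refl  = m≤m+n _ _
  ... | inj₁ j<1+m = ≤-trans (squarePrefix≤squarePrefixes m u 1≤j (≤-pred j<1+m)) (m≤n+m _ _)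

  sqFree : List A → ℕ
  sqFree []      = 1
  sqFree (x ∷ w) = sqFree w * 𝟙 (squarePrefixes (length (x ∷ w)) (x ∷ w) ℕ.≟ 0)

  sqFree-++ : ∀ a b → sqFree (a ++ b) ≤ sqFree b
  sqFree-++ []      b = ≤-refl
  sqFree-++ (x ∷ a) b = ≤-trans (*𝟙≤ (sqFree (a ++ b)) _) (sqFree-++ a b)

  sqFree-∷ : ∀ x w →
    sqFree w ≤ sqFree (x ∷ w) + squarePrefixes (length (x ∷ w)) (x ∷ w) * sqFree w
  sqFree-∷ x w = split (squarePrefixes (length (x ∷ w)) (x ∷ w))
    where
    split : ∀ s → sqFree w ≤ sqFree w * 𝟙 (s ℕ.≟ 0) + s * sqFree w
    split zero    = ≤-reflexive (sym (trans (+-identityʳ _) (*-identityʳ _)))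
    split (suc s) = ≤-trans (m≤m+n _ _)
                            (≤-reflexive (cong (_+ (sqFree w + s * sqFree w)) (sym (*-zeroʳ (sqFree w)))))

  sqFree-sound : ∀ w → 1 ≤ sqFree w → SquareFree w
  sqFree-sound []      _   ys ys≢[] (as , bs , e) =
    ys≢[] (++-conicalˡ ys ys (++-conicalˡ (ys ++ ys) bs (++-conicalʳ as _ e)))
  sqFree-sound (x ∷ w) pos ys ys≢[] (_ ∷ as , bs , e) =
    sqFree-sound w (proj₁ (*𝟙-positive (sqFree w) _ pos)) ys ys≢[] (as , bs , ∷-injectiveʳ e)
  sqFree-sound (x ∷ w) pos ys ys≢[] ([] , bs , e) =
    1+n≰n (subst₂ _≤_ square (proj₂ (*𝟙-positive (sqFree w) _ pos))
      (squarePrefix≤squarePrefixes (length (x ∷ w)) (x ∷ w) (length-positive ys≢[])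
        (subst (λ v → length ys ≤ length v) x∷w≡ (length-++-≤ˡ ys))))
    where
    x∷w≡ : ys ++ ys ++ bs ≡ x ∷ w
    x∷w≡ = trans (sym (++-assoc ys ys bs)) e
    square : squarePrefix (length ys) (x ∷ w) ≡ 1
    square = begin
      squarePrefix (length ys) (x ∷ w)          ≡⟨ cong (squarePrefix (length ys)) x∷w≡ ⟨
      squarePrefix (length ys) (ys ++ ys ++ bs) ≡⟨ squarePrefix-++ ys (ys ++ bs) ⟩
      δ ys (take (length ys) (ys ++ bs))        ≡⟨ cong (δ ys) (take-length-++ ys bs) ⟩
      δ ys ys                                   ≡⟨ 𝟙-yes _ refl ⟩
      1                                         ∎
      where open ≡-Reasoning

  #squareFree : List (List A) → ℕ
  #squareFree Ls = ∑words Ls sqFree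

  #squareFreeDrops : ℕ → List (List A) → ℕ
  #squareFreeDrops zero    Ls = 0
  #squareFreeDrops (suc m) Ls = #squareFree (drop (suc m) Ls) + #squareFreeDrops m Ls

  #squareFreeDrops-∷ : ∀ m L Ls →
    #squareFreeDrops (suc m) (L ∷ Ls) ≡ #squareFree Ls + #squareFreeDrops m Ls
  #squareFreeDrops-∷ zero    L Ls = refl
  #squareFreeDrops-∷ (suc m) L Ls =
    trans (cong (#squareFree (drop (suc m) Ls) +_) (#squareFreeDrops-∷ m L Ls))
          (x∙yz≈y∙xz (#squareFree (drop (suc m) Ls)) (#squareFree Ls) (#squareFreeDrops m Ls))

  -- A word u u v with u of length j is determined by u v, which is square-free when u u v
  -- has a square-free tail.
  ∑words-squarePrefix : ∀ Ls → All Unique Ls → ∀ j → suc j ≤ length Ls →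
    ∑words Ls (λ u → squarePrefix (suc j) u * sqFree (drop 1 u)) ≤ #squareFree (drop (suc j) Ls)
  ∑words-squarePrefix Ls us j j<|Ls| = begin
    ∑words Ls g
      ≡⟨ cong (λ Ls′ → ∑words Ls′ g) (take++drop≡id (suc j) Ls) ⟨
    ∑words (Ks ++ Ms) g
      ≡⟨ ∑words-++ Ks Ms g ⟩
    ∑words Ks (λ a → ∑words Ms (g ∘ (a ++_)))
      ≤⟨ ∑words-mono Ks (λ a |a| → ∑words-mono Ms (λ b _ → bound a b (trans |a| |Ks|))) ⟩
    ∑words Ks (λ a → ∑words Ms (λ b → δ a (take (suc j) b) * sqFree b))
      ≡⟨ ∑words-comm Ks Ms _ ⟩
    ∑words Ms (λ b → ∑words Ks (λ a → δ a (take (suc j) b) * sqFree b))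
      ≤⟨ ∑words-mono Ms (λ b _ → ∑words-δ Ks (take⁺ (suc j) us) (take (suc j) b) (sqFree b)) ⟩
    #squareFree Ms ∎
    where
    open ≤-Reasoning
    Ks Ms : List (List A)
    Ks = take (suc j) Ls
    Ms = drop (suc j) Ls
    g : List A → ℕ
    g u = squarePrefix (suc j) u * sqFree (drop 1 u)
    |Ks| : length Ks ≡ suc j
    |Ks| = trans (length-take (suc j) Ls) (m≤n⇒m⊓n≡m j<|Ls|)
    bound : ∀ a b → length a ≡ suc j → g (a ++ b) ≤ δ a (take (suc j) b) * sqFree b
    bound (x ∷ a) b e =
      subst (λ k → squarePrefix k (x ∷ a ++ b) * sqFree (a ++ b) ≤ δ (x ∷ a) (take k b) * sqFree b)
            e (*-mono-≤ (≤-reflexive (squarePrefix-++ (x ∷ a) b)) (sqFree-++ a b))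

  ∑words-squarePrefixes : ∀ Ls → All Unique Ls → ∀ m → m ≤ length Ls →
    ∑words Ls (λ u → squarePrefixes m u * sqFree (drop 1 u)) ≤ #squareFreeDrops m Ls
  ∑words-squarePrefixes Ls us zero    _      = ≤-reflexive (∑words-zero Ls (λ _ → refl))
  ∑words-squarePrefixes Ls us (suc m) m<|Ls| = begin
    ∑words Ls (λ u → squarePrefixes (suc m) u * sqFree (drop 1 u))
      ≡⟨ ∑words-cong Ls (λ u → *-distribʳ-+ (sqFree (drop 1 u)) (squarePrefix (suc m) u) _) ⟩
    ∑words Ls (λ u → squarePrefix (suc m) u * sqFree (drop 1 u)
                     + squarePrefixes m u * sqFree (drop 1 u))
      ≡⟨ ∑words-+ Ls _ _ ⟩
    ∑words Ls (λ u → squarePrefix (suc m) u * sqFree (drop 1 u))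
      + ∑words Ls (λ u → squarePrefixes m u * sqFree (drop 1 u))
      ≤⟨ +-mono-≤ (∑words-squarePrefix Ls us m m<|Ls|)
                  (∑words-squarePrefixes Ls us m (<⇒≤ m<|Ls|)) ⟩
    #squareFreeDrops (suc m) Ls ∎
    where open ≤-Reasoning

  -- Extending a square-free word by a letter gives a square-free word or one that begins
  -- with a square.
  #squareFree-∷ : ∀ L Ls → All Unique (L ∷ Ls) →
    length L * #squareFree Ls
      ≤ #squareFree (L ∷ Ls) + (#squareFree Ls + #squareFreeDrops (length Ls) Ls)
  #squareFree-∷ L Ls us = begin
    length L * #squareFree Ls
      ≡⟨ ∑-const L _ ⟨
    ∑ L (λ _ → ∑words Ls sqFree)
      ≤⟨ ∑-mono L (λ x → ∑words-mono Ls (extend x)) ⟩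
    ∑ L (λ x → ∑words Ls (λ w → sqFree (x ∷ w) + squares (x ∷ w) * sqFree w))
      ≡⟨ ∑-cong L (λ x → ∑words-+ Ls _ _) ⟩
    ∑ L (λ x → ∑words Ls (sqFree ∘ (x ∷_)) + ∑words Ls (λ w → squares (x ∷ w) * sqFree w))
      ≡⟨ ∑-+ L _ _ ⟩
    #squareFree (L ∷ Ls) + ∑words (L ∷ Ls) (λ u → squares u * sqFree (drop 1 u))
      ≤⟨ +-monoʳ-≤ _ (∑words-squarePrefixes (L ∷ Ls) us (suc (length Ls)) ≤-refl) ⟩
    #squareFree (L ∷ Ls) + #squareFreeDrops (suc (length Ls)) (L ∷ Ls)
      ≡⟨ cong (#squareFree (L ∷ Ls) +_) (#squareFreeDrops-∷ (length Ls) L Ls) ⟩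
    #squareFree (L ∷ Ls) + (#squareFree Ls + #squareFreeDrops (length Ls) Ls) ∎
    where
    open ≤-Reasoning
    squares : List A → ℕ
    squares = squarePrefixes (suc (length Ls))
    extend : ∀ x w → length w ≡ length Ls → sqFree w ≤ sqFree (x ∷ w) + squares (x ∷ w) * sqFree w
    extend x w |w| rewrite sym |w| = sqFree-∷ x w

  #squareFree-grows : ∀ Ls → All Unique Ls → All (λ L → 4 ≤ length L) Ls →
    1 ≤ #squareFree Ls × #squareFreeDrops (length Ls) Ls ≤ #squareFree Ls
  #squareFree-grows []       _          _            = s≤s z≤n , z≤n
  #squareFree-grows (L ∷ Ls) (uL ∷ uLs) (4≤|L| ∷ 4≤) =
    ≤-trans 1≤c (≤-trans (m≤m+n c (c + 0)) 2c≤c′) , drops≤c′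
    where
    open ≤-Reasoning
    c c′ : ℕ
    c = #squareFree Ls
    c′ = #squareFree (L ∷ Ls)
    1≤c : 1 ≤ c
    1≤c = proj₁ (#squareFree-grows Ls uLs 4≤)
    drops≤c : #squareFreeDrops (length Ls) Ls ≤ c
    drops≤c = proj₂ (#squareFree-grows Ls uLs 4≤)
    2c≤c′ : 2 * c ≤ c′
    2c≤c′ = +-cancelʳ-≤ (2 * c) (2 * c) c′ (begin
      2 * c + 2 * c                              ≡⟨ *-distribʳ-+ c 2 2 ⟨
      4 * c                                      ≤⟨ *-monoˡ-≤ c 4≤|L| ⟩
      length L * c                               ≤⟨ #squareFree-∷ L Ls (uL ∷ uLs) ⟩
      c′ + (c + #squareFreeDrops (length Ls) Ls) ≤⟨ +-monoʳ-≤ c′ (+-monoʳ-≤ c drops≤c) ⟩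
      c′ + (c + c)                               ≡⟨ cong (λ k → c′ + (c + k)) (+-identityʳ c) ⟨
      c′ + 2 * c                                 ∎)
    drops≤c′ : #squareFreeDrops (suc (length Ls)) (L ∷ Ls) ≤ c′
    drops≤c′ = begin
      #squareFreeDrops (suc (length Ls)) (L ∷ Ls) ≡⟨ #squareFreeDrops-∷ (length Ls) L Ls ⟩
      c + #squareFreeDrops (length Ls) Ls         ≤⟨ +-monoʳ-≤ c drops≤c ⟩
      c + c                                       ≡⟨ cong (c +_) (+-identityʳ c) ⟨
      2 * c                                       ≤⟨ 2c≤c′ ⟩
      c′                                          ∎

  squareFree-choice : ∀ m (L : Fin m → List A) → (∀ t → Unique (L t)) →
    (∀ t → 4 ≤ length (L t)) → ∃ λ c → (∀ t → c t ∈ L t) × SquareFree (tabulate c)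
  squareFree-choice m L u 4≤
    with ∑words-positive (tabulate L) sqFree
           (proj₁ (#squareFree-grows (tabulate L) (tabulate⁺ u) (tabulate⁺ 4≤)))
  ... | w , w∈L , pos with pointwise-tabulate⁻ w∈L
  ...   | c , c∈L , refl = c , c∈L , sqFree-sound (tabulate c) pos

-- Colourings with uniquely coloured vertices

module _ {B C : Set} (f : B → C) where

  infix-map : ∀ {q w} → Infix q w → Infix (map f q) (map f w)
  infix-map {q} (as , bs , refl) =
    map f as , map f bs , sym (trans (map-++ f as (q ++ bs)) (cong (map f as ++_) (map-++ f q bs)))

  map-++⁻ : ∀ xs {ys zs} → map f xs ≡ ys ++ zs →
    ∃₂ λ xs₁ xs₂ → xs ≡ xs₁ ++ xs₂ × map f xs₁ ≡ ys × map f xs₂ ≡ zs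
  map-++⁻ xs       {[]}     e = [] , xs , refl , refl , e
  map-++⁻ (x ∷ xs) {y ∷ ys} e with map-++⁻ xs (∷-injectiveʳ e)
  ... | xs₁ , xs₂ , refl , e₁ , e₂ =
    x ∷ xs₁ , xs₂ , refl , cong₂ _∷_ (∷-injectiveˡ e) e₁ , e₂

  map-map-tabulate : ∀ {D : Set} {m} (g : D → B) (h : Fin m → D) →
    map f (map g (tabulate h)) ≡ tabulate (f ∘ g ∘ h)
  map-map-tabulate g h = trans (sym (map-∘ (tabulate h))) (map-tabulate h (f ∘ g))

tabulate-inject₁ : ∀ {B : Set} k (f : Fin (suc k) → B) →
  tabulate f ≡ tabulate (f ∘ inject₁) ++ [ f (fromℕ k) ]
tabulate-inject₁ zero    f = refl
tabulate-inject₁ (suc k) f = cong (f zero ∷_) (tabulate-inject₁ k (f ∘ suc))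

map-allFin-suc : ∀ {B : Set} k (g : Fin (suc k) → B) →
  map g (allFin (suc k)) ≡ map (g ∘ inject₁) (allFin k) ++ [ g (fromℕ k) ]
map-allFin-suc k g = begin
  map g (allFin (suc k))                          ≡⟨ map-tabulate id g ⟩
  tabulate g                                      ≡⟨ tabulate-inject₁ k g ⟩
  tabulate (g ∘ inject₁) ++ [ g (fromℕ k) ]       ≡⟨ cong (_++ _) (map-tabulate id (g ∘ inject₁)) ⟨
  map (g ∘ inject₁) (allFin k) ++ [ g (fromℕ k) ] ∎
  where open ≡-Reasoning

∈-zip-infix : ∀ {B : Set} {x y c d : B} R →
  (x , y) ∈ zip (c ∷ R) (R ++ [ d ]) → Infix (x ∷ y ∷ []) (c ∷ R ++ [ d ])
∈-zip-infix []      (here refl) = [] , [] , refl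
∈-zip-infix (_ ∷ R) (here refl) = [] , R ++ [ _ ] , refl
∈-zip-infix (r ∷ R) (there xy∈) = infix-∷ _ (∈-zip-infix R xy∈)

element : ∀ {B : Set} {xs : List B} → 1 ≤ length xs → ∃ (_∈ xs)
element {xs = x ∷ _} _ = x , here refl

repetition-length : ∀ {xs} → IsRepetition xs → 2 ≤ length xs
repetition-length ([]     , ys≢[] , _)    = ⊥-elim (ys≢[] refl)
repetition-length (y ∷ ys , _     , refl) = s≤s (≤-trans (s≤s z≤n) (length-++-≤ʳ (y ∷ ys) {ys}))

module _ {V : Set} (φ : V → ℕ) where

  reverse-repetition : ∀ {q} → IsRepetition (map φ q) → IsRepetition (map φ (reverse q))
  reverse-repetition {q} (ys , ys≢[] , e) =
    reverse ys , ys≢[] ∘ reverse-injective {x = ys} {y = []} , (begin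
      map φ (reverse q)        ≡⟨ reverse-map φ q ⟩
      reverse (map φ q)        ≡⟨ cong reverse e ⟩
      reverse (ys ++ ys)       ≡⟨ reverse-++ ys ys ⟩
      reverse ys ++ reverse ys ∎)
    where open ≡-Reasoning

  squareFree⇒¬repetition : ∀ {q w} → SquareFree (map φ w) → Infix q w →
    ¬ IsRepetition (map φ q)
  squareFree⇒¬repetition sf i (ys , ys≢[] , e) =
    sf ys ys≢[] (subst (λ u → Infix u _) e (infix-map φ i))

  ∈-map-twin : ∀ {v xs ys} → (∀ u → φ u ≡ φ v → u ≡ v) → map φ xs ≡ map φ ys →
    v ∈ xs → v ∈ ys
  ∈-map-twin only-v e v∈xs with ∈-map⁻ φ (subst (φ _ ∈_) e (∈-map⁺ φ v∈xs))
  ... | u , u∈ys , φv≡φu = subst (_∈ _) (only-v u (sym φv≡φu)) u∈ys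

  uniqueColour-∉ : ∀ {v p} → (∀ u → φ u ≡ φ v → u ≡ v) → Unique p →
    IsRepetition (map φ p) → v ∉ p
  uniqueColour-∉ {p = p} only-v u (ys , _ , e) v∈p with map-++⁻ φ p {ys} {ys} e
  ... | p₁ , p₂ , refl , e₁ , e₂ with ∈-++⁻ p₁ v∈p
  ...   | inj₁ v∈p₁ = unique-++-disjoint u v∈p₁ (∈-map-twin only-v (trans e₁ (sym e₂)) v∈p₁)
  ...   | inj₂ v∈p₂ = unique-++-disjoint u (∈-map-twin only-v (trans e₂ (sym e₁)) v∈p₂) v∈p₂

ForwardNonRepetitive : (G : PlaneGraph) → (V G → ℕ) → Set
ForwardNonRepetitive G φ =
  ∀ {w q} → w ∈ faces G → Segment q w → Unique q → ¬ IsRepetition (map φ q)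

facialNonRepetitive : ∀ G φ → ForwardNonRepetitive G φ → FacialNonRepetitive G φ
facialNonRepetitive G φ forward p (w , w∈G , _ , u , inj₁ seg) rep = forward w∈G seg u rep
facialNonRepetitive G φ forward p (w , w∈G , _ , u , inj₂ seg) rep =
  forward w∈G seg (unique-reverse u) (reverse-repetition φ rep)

FNRChoosable-mono : ∀ {G l l′} → l ≤ l′ → FNRChoosable G l → FNRChoosable G l′
FNRChoosable-mono l≤l′ choose L adm = choose L (map₂ (map₂ (≤-trans l≤l′)) ∘ adm)

infixl 5 _∖_

_∖_ : List ℕ → ℕ → List ℕ
L ∖ a = filter (λ x → ¬? (x ≟ a)) L

∈-∖⁻ : ∀ {x} L a → x ∈ L ∖ a → x ∈ L × x ≢ a
∈-∖⁻ L a = ∈-filter⁻ (λ x → ¬? (x ≟ a))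

length-∖ : ∀ {L} a → Unique L → length L ≤ suc (length (L ∖ a))
length-∖ {[]}    a []        = z≤n
length-∖ {x ∷ L} a (x∉L ∷ u) with x ≟ a
... | yes refl = s≤s (≤-reflexive (cong length (sym x∷L∖x≡L)))
  where
  x∷L∖x≡L : (x ∷ L) ∖ x ≡ L
  x∷L∖x≡L = trans (filter-reject (λ y → ¬? (y ≟ x)) (λ x≢x → x≢x refl))
                  (filter-all (λ y → ¬? (y ≟ x)) (All.map (_∘ sym) x∉L))
... | no x≢a =
  s≤s (≤-trans (length-∖ a u)
               (≤-reflexive (cong length (sym (filter-accept (λ y → ¬? (y ≟ a)) x≢a)))))

∖-admissible : ∀ {L l} a → Unique L → suc l ≤ length L →
  Unique (L ∖ a) × l ≤ length (L ∖ a)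
∖-admissible a u l<|L| = filter⁺ (λ x → ¬? (x ≟ a)) u , ≤-pred (≤-trans l<|L| (length-∖ a u))

-- Stars, subdivided stars and wheels

some-colour : ∀ G {l L} → ListAssignment G (suc l) L → ∀ v → ∃ (_∈ L v)
some-colour G adm v = element (≤-trans (s≤s z≤n) (proj₂ (proj₂ (adm v))))

reserve : ∀ G {l L} → ListAssignment G (suc l) L → ∀ a v →
  Unique (L v ∖ a) × l ≤ length (L v ∖ a)
reserve G adm a v = ∖-admissible a (proj₁ (adm v)) (proj₂ (proj₂ (adm v)))

star-choosable : ∀ n → FNRChoosable (star n) 2
star-choosable n L adm = φ , φ∈L , facialNonRepetitive (star n) φ forward
  where
  a : ℕ
  a = proj₁ (some-colour (star n) adm nothing)
  leaf : ∀ i → ∃ (_∈ L (just i) ∖ a)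
  leaf i = element (proj₂ (reserve (star n) adm a (just i)))
  φ : Maybe (Fin n) → ℕ
  φ nothing  = a
  φ (just i) = proj₁ (leaf i)
  leaf-ok : ∀ i → φ (just i) ∈ L (just i) × φ (just i) ≢ a
  leaf-ok i = ∈-∖⁻ (L (just i)) a (proj₂ (leaf i))
  φ∈L : ∀ v → φ v ∈ L v
  φ∈L nothing  = proj₂ (some-colour (star n) adm nothing)
  φ∈L (just i) = proj₁ (leaf-ok i)
  only-centre : ∀ v → φ v ≡ a → v ≡ nothing
  only-centre nothing  _ = refl
  only-centre (just i) e = ⊥-elim (proj₂ (leaf-ok i) e)
  forward : ForwardNonRepetitive (star n) φ
  forward {q = q} (here refl) seg u rep
    with segment-blocks (λ i → [ just i ]) (allFin n) seg (uniqueColour-∉ φ only-centre u rep)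
  ... | _ , inf = ≤⇒≯ (infix-length inf) (subst (2 ≤_) (length-map φ q) (repetition-length rep))

star-centre-leaf : ∀ n → FacialPath (star (suc n)) (nothing ∷ just zero ∷ [])
star-centre-leaf n =
  _ , here refl , (λ ()) , ((λ ()) ∷ []) ∷ [] ∷ [] , inj₁ (0 , s≤s z≤n , _ , refl)

star-not-1-choosable : ∀ n → ¬ FNRChoosable (star (suc n)) 1
star-not-1-choosable n choose
  with choose (λ _ → [ 1 ]) (λ _ → ([] ∷ []) , (s≤s z≤n ∷ []) , s≤s z≤n)
... | φ , φ∈L , nonrep =
  nonrep _ (star-centre-leaf n) ([ φ nothing ] , (λ ()) , cong (λ k → φ nothing ∷ k ∷ []) same)
  where
  one : ∀ v → φ v ≡ 1
  one v with here e ← φ∈L v = e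
  same : φ (just zero) ≡ φ nothing
  same = trans (one (just zero)) (sym (one nothing))

star-lower : ∀ n l → FNRChoosable (star (suc n)) l → 2 ≤ l
star-lower n l choose with 2 ≤? l
... | yes 2≤l = 2≤l
... | no 2≰l  = ⊥-elim (star-not-1-choosable n (FNRChoosable-mono (≤-pred (≰⇒> 2≰l)) choose))

subdividedStar-choosable : ∀ n ks → FNRChoosable (subdividedStar n ks) 5
subdividedStar-choosable n ks L adm = φ , φ∈L , facialNonRepetitive (subdividedStar n ks) φ forward
  where
  a : ℕ
  a = proj₁ (some-colour (subdividedStar n ks) adm nothing)
  branch : ∀ i → ∃ λ c → (∀ j → c j ∈ L (just (i , j)) ∖ a) × SquareFree (tabulate c)
  branch i = squareFree-choice _≟_ (suc (ks i)) (λ j → L (just (i , j)) ∖ a)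
                               (λ j → proj₁ (reserve (subdividedStar n ks) adm a (just (i , j))))
                               (λ j → proj₂ (reserve (subdividedStar n ks) adm a (just (i , j))))
  φ : SubStarV n ks → ℕ
  φ nothing        = a
  φ (just (i , j)) = proj₁ (branch i) j
  branch-ok : ∀ i j → φ (just (i , j)) ∈ L (just (i , j)) × φ (just (i , j)) ≢ a
  branch-ok i j = ∈-∖⁻ (L (just (i , j))) a (proj₁ (proj₂ (branch i)) j)
  φ∈L : ∀ v → φ v ∈ L v
  φ∈L nothing        = proj₂ (some-colour (subdividedStar n ks) adm nothing)
  φ∈L (just (i , j)) = proj₁ (branch-ok i j)
  only-centre : ∀ v → φ v ≡ a → v ≡ nothing
  only-centre nothing        _ = refl
  only-centre (just (i , j)) e = ⊥-elim (proj₂ (branch-ok i j) e)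
  out : Fin n → List (SubStarV n ks)
  out i = map (λ j → just (i , j)) (allFin (suc (ks i)))
  back : Fin n → List (SubStarV n ks)
  back i = map (λ j → just (i , inject₁ j)) (allFin (ks i))
  out-squareFree : ∀ i → SquareFree (map φ (out i))
  out-squareFree i =
    subst SquareFree (sym (map-map-tabulate φ (λ j → just (i , j)) id)) (proj₂ (proj₂ (branch i)))
  forward : ForwardNonRepetitive (subdividedStar n ks) φ
  forward (here refl) seg u rep
    with segment-blocks (λ i → out i ++ reverse (back i)) (allFin n) seg
                        (uniqueColour-∉ φ only-centre u rep)
  ... | i , inf with out-and-back (back i) _ (map-allFin-suc (ks i) (λ j → just (i , j))) u inf
  ...   | inj₁ along   = squareFree⇒¬repetition φ (out-squareFree i) along rep
  ...   | inj₂ against =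
    squareFree⇒¬repetition φ (out-squareFree i) against (reverse-repetition φ rep)

wheel-choosable : ∀ n → FNRChoosable (wheel (suc n)) 6
wheel-choosable n L adm = φ , φ∈L , facialNonRepetitive (wheel (suc n)) φ forward
  where
  a : ℕ
  a = proj₁ (some-colour (wheel (suc n)) adm nothing)
  rim₀ : ∃ (_∈ L (just zero) ∖ a)
  rim₀ = element (≤-trans (s≤s z≤n) (proj₂ (reserve (wheel (suc n)) adm a (just zero))))
  b : ℕ
  b = proj₁ rim₀
  reserved : ∀ t → Unique (L (just (suc t)) ∖ a ∖ b) × 4 ≤ length (L (just (suc t)) ∖ a ∖ b)
  reserved t = uncurry (∖-admissible b) (reserve (wheel (suc n)) adm a (just (suc t)))
  path : ∃ λ c → (∀ t → c t ∈ L (just (suc t)) ∖ a ∖ b) × SquareFree (tabulate c)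
  path = squareFree-choice _≟_ n (λ t → L (just (suc t)) ∖ a ∖ b)
                           (proj₁ ∘ reserved) (proj₂ ∘ reserved)
  φ : Maybe (Fin (suc n)) → ℕ
  φ nothing        = a
  φ (just zero)    = b
  φ (just (suc t)) = proj₁ path t
  b-ok : b ∈ L (just zero) × b ≢ a
  b-ok = ∈-∖⁻ (L (just zero)) a (proj₂ rim₀)
  path-ok : ∀ t → φ (just (suc t)) ∈ L (just (suc t)) ∖ a × φ (just (suc t)) ≢ b
  path-ok t = ∈-∖⁻ (L (just (suc t)) ∖ a) b (proj₁ (proj₂ path) t)
  path-ok′ : ∀ t → φ (just (suc t)) ∈ L (just (suc t)) × φ (just (suc t)) ≢ a
  path-ok′ t = ∈-∖⁻ (L (just (suc t))) a (proj₁ (path-ok t))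
  φ∈L : ∀ v → φ v ∈ L v
  φ∈L nothing        = proj₂ (some-colour (wheel (suc n)) adm nothing)
  φ∈L (just zero)    = proj₁ b-ok
  φ∈L (just (suc t)) = proj₁ (path-ok′ t)
  only-hub : ∀ v → φ v ≡ a → v ≡ nothing
  only-hub nothing        _ = refl
  only-hub (just zero)    e = ⊥-elim (proj₂ b-ok e)
  only-hub (just (suc t)) e = ⊥-elim (proj₂ (path-ok′ t) e)
  only-rim₀ : ∀ v → φ v ≡ b → v ≡ just zero
  only-rim₀ nothing        e = ⊥-elim (proj₂ b-ok (sym e))
  only-rim₀ (just zero)    _ = refl
  only-rim₀ (just (suc t)) e = ⊥-elim (proj₂ (path-ok t) e)
  R : List (Maybe (Fin (suc n)))
  R = map just (tabulate suc)
  along-R : ∀ {q} → Infix q R → ¬ IsRepetition (map φ q)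
  along-R = squareFree⇒¬repetition φ
              (subst SquareFree (sym (map-map-tabulate φ just suc)) (proj₂ (proj₂ path)))
  forward : ForwardNonRepetitive (wheel (suc n)) φ
  forward (here refl) seg u rep =
    along-R (segment-avoiding seg (uniqueColour-∉ φ only-rim₀ u rep)) rep
  forward {q = q} (there w∈triangles) seg u rep with ∈-map⁻ _ w∈triangles
  ... | _ , xy∈ , refl = along-R (rotation-avoiding 1 R rim₀∉q (infix-∷⁻ rim₀∉q on-rim)) rep
    where
    rim₀∉q : just zero ∉ q
    rim₀∉q = uniqueColour-∉ φ only-rim₀ u rep
    on-rim : Infix q (just zero ∷ R ++ [ just zero ])
    on-rim = infix-trans (segment-avoiding seg (uniqueColour-∉ φ only-hub u rep)) (∈-zip-infix R xy∈)

theorem6 : (n : ℕ) → 1 ≤ n →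
    PiFL≡ (star n) 2
    × ((ks : Fin n → ℕ) → PiFL≤ (subdividedStar n ks) 5)
    × (3 ≤ n → PiFL≤ (wheel n) 6)
theorem6 (suc n) _ =
  (star-choosable (suc n) , star-lower n) , subdividedStar-choosable (suc n) , λ _ → wheel-choosable n
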